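{- Let $p$ be a prime, $n=p^2$, and let $\Gamma=\Gamma(D_{2n})$ be the intersection graph of $D_{2n}$. Then the eccentric connectivity index of $\Gamma$ is $\xi^c(\Gamma)=7p^2+6p+4$.
   Context: $D_{2n}=\langle r,s : r^n=s^2=1,\ srs=r^{ -1}\rangle$ is the dihedral group of order $2n$. The intersection graph $\Gamma(G)$ of a finite group $G$ has as vertices the proper non-trivial subgroups of $G$, two distinct vertices being adjacent iff their intersection is non-trivial. The eccentric connectivity index is $\xi^c(\Gamma)=\sum_{v\in V(\Gamma)}\deg(v)\operatorname{ecc}(v)$, where $\operatorname{ecc}(v)$ is the largest distance from $v$ to any other vertex. -}

module Defs where

open import Data.Nat using (ℕ; zero; suc; _+_; _*_; _∸_; _%_)
open import Data.Nat.DivMod using (m%n<n)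
open import Data.Bool using (Bool; true; false)
import Data.Bool.Properties as BoolP
open import Data.Fin using (Fin; toℕ; fromℕ<)
import Data.Fin.Properties as FinP
open import Data.Fin.Subset using (Subset; _∈_; _∉_; inside; outside)
open import Data.Fin.Subset.Properties using (_∈?_)
open import Data.Vec using (Vec; []; _∷_)
import Data.Vec.Properties as VecP
open import Data.Nat.ListAction using (sum)
open import Data.List using (List; []; _∷_; [_]; filter; length; map; foldr; cartesianProduct; _++_)
open import Data.List.Relation.Unary.Any using (Any)
import Data.List.Relation.Unary.Any as Any
open import Data.Product using (Σ; _×_; _,_; ∃)
import Data.Product.Properties as ProdP
open import Data.Sum using (_⊎_)
open import Relation.Binary.PropositionalEquality using (_≡_; _≢_)
open import Relation.Binary.Definitions using (DecidableEquality)
open import Relation.Nullary using (Dec; yes; no; ¬_; ¬?)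
open import Relation.Nullary.Decidable using (_×-dec_; _⊎-dec_; _→-dec_)
open import Data.Nat using (_⊔_)

-- The dihedral group D_{2n} for n = suc m ≥ 1.
-- The element (k , b) represents r^k s^b  (k ∈ Z/n, b ∈ {0,1}).

module Dihedral (m : ℕ) where

  N : ℕ
  N = suc m

  _⊕_ : Fin N → Fin N → Fin N
  i ⊕ j = fromℕ< (m%n<n (toℕ i + toℕ j) N)

  ⊖_ : Fin N → Fin N
  ⊖ i = fromℕ< (m%n<n (N ∸ toℕ i) N)

  G : Set
  G = Fin N × Bool

  e : G
  e = (Fin.zero , false)

  -- r^a s^b · r^c s^d = r^(a + (-1)^b c) s^(b+d),  using s r^c = r^(-c) s
  _·_ : G → G → G
  (a , false) · (c , false) = (a ⊕ c , false)
  (a , false) · (c , true)  = (a ⊕ c , true)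
  (a , true)  · (c , false) = (a ⊕ (⊖ c) , true)
  (a , true)  · (c , true)  = (a ⊕ (⊖ c) , false)

  inv : G → G
  inv (a , false) = (⊖ a , false)
  inv (a , true)  = (a , true)

  _≟G_ : DecidableEquality G
  _≟G_ = ProdP.≡-dec FinP._≟_ BoolP._≟_

  ∀G? : {P : G → Set} → (∀ x → Dec (P x)) → Dec (∀ x → P x)
  ∀G? {P} P? with FinP.all? (λ a → P? (a , false)) | FinP.all? (λ a → P? (a , true))
  ... | yes f | yes g = yes λ { (a , false) → f a ; (a , true) → g a }
  ... | no ¬f | _     = no λ h → ¬f (λ a → h (a , false))
  ... | yes _ | no ¬g = no λ h → ¬g (λ a → h (a , true))

  ∃G? : {P : G → Set} → (∀ x → Dec (P x)) → Dec (Σ G P)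
  ∃G? {P} P? with FinP.any? (λ a → P? (a , false)) | FinP.any? (λ a → P? (a , true))
  ... | yes (a , pa) | _ = yes ((a , false) , pa)
  ... | no _ | yes (a , pa) = yes ((a , true) , pa)
  ... | no ¬f | no ¬g = no λ { ((a , false) , pa) → ¬f (a , pa) ; ((a , true) , pa) → ¬g (a , pa) }

  -- Subsets of G: a pair (R , S) of subsets of Z/N;
  -- r^k ∈ H iff k ∈ R,  r^k s ∈ H iff k ∈ S.

  SubG : Set
  SubG = Subset N × Subset N

  _∈G_ : G → SubG → Set
  (a , false) ∈G (R , S) = a ∈ R
  (a , true)  ∈G (R , S) = a ∈ S

  _∈G?_ : ∀ x H → Dec (x ∈G H)
  (a , false) ∈G? (R , S) = a ∈? R
  (a , true)  ∈G? (R , S) = a ∈? S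

  _≟S_ : DecidableEquality SubG
  _≟S_ = ProdP.≡-dec (VecP.≡-dec BoolP._≟_) (VecP.≡-dec BoolP._≟_)

  allSubsets : (k : ℕ) → List (Subset k)
  allSubsets zero    = [ [] ]
  allSubsets (suc k) = map (inside ∷_) (allSubsets k) ++ map (outside ∷_) (allSubsets k)

  allSubG : List SubG
  allSubG = cartesianProduct (allSubsets N) (allSubsets N)

  IsSubgroup : SubG → Set
  IsSubgroup H = (e ∈G H)
               × (∀ x → ∀ y → x ∈G H → y ∈G H → (x · y) ∈G H)
               × (∀ x → x ∈G H → inv x ∈G H)

  NonTrivialSub : SubG → Set
  NonTrivialSub H = Σ G (λ x → x ≢ e × x ∈G H)

  ProperSub : SubG → Set
  ProperSub H = Σ G (λ x → ¬ (x ∈G H))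

  IsVertex : SubG → Set
  IsVertex H = IsSubgroup H × NonTrivialSub H × ProperSub H

  isSubgroup? : ∀ H → Dec (IsSubgroup H)
  isSubgroup? H = (e ∈G? H)
    ×-dec ∀G? (λ x → ∀G? (λ y → (x ∈G? H) →-dec ((y ∈G? H) →-dec ((x · y) ∈G? H))))
    ×-dec ∀G? (λ x → (x ∈G? H) →-dec (inv x ∈G? H))

  isVertex? : ∀ H → Dec (IsVertex H)
  isVertex? H = isSubgroup? H
    ×-dec ∃G? (λ x → ¬? (x ≟G e) ×-dec (x ∈G? H))
    ×-dec ∃G? (λ x → ¬? (x ∈G? H))

  V : List SubG
  V = filter isVertex? allSubG

  Adj : SubG → SubG → Set
  Adj H K = H ≢ K × Σ G (λ x → x ≢ e × x ∈G H × x ∈G K)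

  adj? : ∀ H K → Dec (Adj H K)
  adj? H K = ¬? (H ≟S K) ×-dec ∃G? (λ x → ¬? (x ≟G e) ×-dec (x ∈G? H) ×-dec (x ∈G? K))

  deg : SubG → ℕ
  deg H = length (filter (adj? H) V)

  Reach : ℕ → SubG → SubG → Set
  Reach zero    H K = H ≡ K
  Reach (suc k) H K = Reach k H K ⊎ Any (λ W → Reach k H W × Adj W K) V

  reach? : ∀ k H K → Dec (Reach k H K)
  reach? zero    H K = H ≟S K
  reach? (suc k) H K = reach? k H K ⊎-dec Any.any? (λ W → reach? k H W ×-dec adj? W K) V

  search : {P : ℕ → Set} → (∀ k → Dec (P k)) → (fuel start : ℕ) → ℕ
  search P? zero     start = start
  search P? (suc f)  start with P? start
  ... | yes _ = start
  ... | no  _ = search P? f (suc start)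

  -- graph distance d(H,K) = least k with a walk of length k
  -- (distances in a graph on |V| vertices are < |V| when finite)
  dist : SubG → SubG → ℕ
  dist H K = search (λ k → reach? k H K) (length V) 0

  ecc : SubG → ℕ
  ecc H = foldr _⊔_ 0 (map (dist H) V)

  ξc : ℕ
  ξc = sum (map (λ H → deg H * ecc H) V)

-- ξ^c(Γ(D_{2n})) for n ≥ 1 (D_{2·0} is not defined; value 0 is a dummy)
ξcD : ℕ → ℕ
ξcD zero    = 0
ξcD (suc m) = Dihedral.ξc m

module Submission where

open import Defs
open import Level using (0ℓ)
open import Function.Base using (_∘_)
open import Function.Bundles using (mk⇔)
open import Data.Nat
open import Data.Nat.Properties
open import Data.Nat.DivMod
open import Data.Nat.Divisibility using (_∣_; divides; ∣-refl; ∣-trans; 1∣_; n∣m⇒m%n≡0; m%n≡0⇒n∣m)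
open import Data.Nat.GCD using (gcd[m,n]∣m; gcd[m,n]∣n; module Bézout)
open import Data.Nat.Coprimality using (Coprime; coprime-Bézout; coprime-divisor; gcd≡1⇒coprime; prime⇒coprime)
open import Data.Nat.Primality using (Prime; prime⇒irreducible; ¬prime[0]; ¬prime[1])
open import Data.Nat.ListAction using (sum)
open import Data.Nat.ListAction.Properties using (sum-↭; sum-++)
open import Data.Nat.Tactic.RingSolver using (solve-∀)
open import Data.Bool using (true; false)
open import Data.Fin as Fin using (Fin; toℕ; fromℕ<)
open import Data.Fin.Properties using (toℕ-injective; toℕ-fromℕ<; toℕ<n; any?)
open import Data.Fin.Subset using (Subset; _∈_; _∉_; _⊆_; inside; outside; Nonempty) renaming (⊥ to ∅)
open import Data.Fin.Subset.Properties using (∉⊥; ⊆-antisym; Empty-unique; nonempty?) renaming (_∈?_ to _∈ˢ?_)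
open import Data.Vec using ([]; _∷_; tabulate)
open import Data.Vec.Properties using (∷-injectiveʳ; lookup∘tabulate; []=⇒lookup; lookup⇒[]=)
open import Data.List using (List; []; _∷_; _++_; map; filter; length; foldr; upTo; applyUpTo)
open import Data.List.Properties
  using (filter-accept; filter-reject; filter-++; length-++; filter-all; filter-none; map-upTo; length-upTo; length-applyUpTo; map-++)
open import Data.List.Membership.Propositional using (find; lose) renaming (_∈_ to _∈ₗ_)
open import Data.List.Membership.Propositional.Properties
  using (∈-++⁺ˡ; ∈-++⁺ʳ; ∈-++⁻; ∈-map⁺; ∈-map⁻; ∈-filter⁺; ∈-filter⁻; ∈-cartesianProduct⁺; ∈-upTo⁺; ∈-upTo⁻; ∈-applyUpTo⁺; ∈-applyUpTo⁻)
open import Data.List.Membership.Propositional.Properties.WithK using (unique∧set⇒bag)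
open import Data.List.Relation.Unary.All as All using (All)
open import Data.List.Relation.Unary.Any using (here; there)
open import Data.List.Relation.Unary.AllPairs using ([]; _∷_)
open import Data.List.Relation.Unary.Unique.Propositional using (Unique)
import Data.List.Relation.Unary.Unique.Propositional.Properties as Unique
open import Data.List.Relation.Binary.Permutation.Propositional using (_↭_)
open import Data.List.Relation.Binary.Permutation.Propositional.Properties using (filter-↭; ↭-length; map⁺)
open import Data.List.Relation.Binary.BagAndSetEquality using (∼bag⇒↭)
open import Data.Product using (Σ; _×_; _,_; proj₁; proj₂)
open import Data.Sum using (_⊎_; inj₁; inj₂)
open import Relation.Binary.Definitions using (DecidableEquality)
open import Relation.Binary.PropositionalEquality
open import Relation.Nullary using (¬_; Dec; yes; no; ¬?; does)
open import Relation.Nullary.Decidable using (dec-true; _×-dec_)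
open import Relation.Nullary.Negation using (contradiction)
open import Relation.Unary using (Pred; Decidable; ∁)
open import Relation.Unary.Properties using (∁?)

-- Every proper non-trivial subgroup of D_{2p²} is ⟨r⟩, ⟨rᵖ⟩, one of the p dihedral
-- subgroups ⟨rᵖ, rᶜs⟩ (c < p), or one of the p² subgroups {1, rᵏs}: by Bézout a subgroup
-- of rotations is ⟨r⟩, ⟨rᵖ⟩ or trivial, and the reflections of a subgroup form a single
-- coset of its rotations. The first p + 2 of these contain rᵖ and form a clique, while
-- {1, rᵏs} meets only ⟨rᵖ, rᵏ s⟩ (k taken mod p). So the degrees are p + 1, p + 1, 2p + 1
-- and 1, the eccentricities 2, 2, 2 and 3, and
-- ξᶜ = 2·2(p + 1) + p·2(2p + 1) + p²·3 = 7p² + 6p + 4.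

count : {A : Set} {P : Pred A 0ℓ} → Decidable P → List A → ℕ
count P? xs = length (filter P? xs)

module _ {A : Set} where

  module _ {P : Pred A 0ℓ} (P? : Decidable P) where

    count-∷-accept : ∀ {x} xs → P x → count P? (x ∷ xs) ≡ suc (count P? xs)
    count-∷-accept _ = cong length ∘ filter-accept P?

    count-∷-reject : ∀ {x} xs → ¬ P x → count P? (x ∷ xs) ≡ count P? xs
    count-∷-reject _ = cong length ∘ filter-reject P?

    count-++ : ∀ xs ys → count P? (xs ++ ys) ≡ count P? xs + count P? ys
    count-++ xs ys = trans (cong length (filter-++ P? xs ys)) (length-++ (filter P? xs))

    count-all : ∀ {xs} → All P xs → count P? xs ≡ length xs
    count-all = cong length ∘ filter-all P?

    count-none : ∀ {xs} → All (∁ P) xs → count P? xs ≡ 0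
    count-none = cong length ∘ filter-none P?

    count+count-∁ : ∀ xs → count P? xs + count (∁? P?) xs ≡ length xs
    count+count-∁ []       = refl
    count+count-∁ (x ∷ xs) with P? x
    ... | yes _ = cong suc (count+count-∁ xs)
    ... | no  _ = trans (+-suc _ _) (cong suc (count+count-∁ xs))

    count-map : ∀ {B : Set} (f : B → A) xs → count P? (map f xs) ≡ count (P? ∘ f) xs
    count-map f []       = refl
    count-map f (x ∷ xs) with P? (f x)
    ... | yes _ = cong suc (count-map f xs)
    ... | no  _ = count-map f xs

    count-≐ : ∀ {Q : Pred A 0ℓ} (Q? : Decidable Q) xs →
              (∀ {x} → x ∈ₗ xs → P x → Q x) → (∀ {x} → x ∈ₗ xs → Q x → P x) →
              count P? xs ≡ count Q? xs
    count-≐ Q? []       P⇒Q Q⇒P = refl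
    count-≐ Q? (x ∷ xs) P⇒Q Q⇒P with P? x | Q? x
    ... | yes _  | yes _  = cong suc (count-≐ Q? xs (P⇒Q ∘ there) (Q⇒P ∘ there))
    ... | no  _  | no  _  = count-≐ Q? xs (P⇒Q ∘ there) (Q⇒P ∘ there)
    ... | yes px | no ¬qx = contradiction (P⇒Q (here refl) px) ¬qx
    ... | no ¬px | yes qx = contradiction (Q⇒P (here refl) qx) ¬px

  count-≟-unique : (_≟_ : DecidableEquality A) {x : A} {xs : List A} →
                   Unique xs → x ∈ₗ xs → count (_≟ x) xs ≡ 1
  count-≟-unique _≟_ {x} (x∉xs ∷ _) (here refl) with x ≟ x
  ... | yes _  = cong suc (count-none (_≟ x) (All.map (λ x≢y y≡x → x≢y (sym y≡x)) x∉xs))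
  ... | no x≢x = contradiction refl x≢x
  count-≟-unique _≟_ {x} {y ∷ _} (y∉xs ∷ u) (there x∈xs) with y ≟ x
  ... | yes refl = contradiction refl (All.lookup y∉xs x∈xs)
  ... | no  _    = count-≟-unique _≟_ u x∈xs

  sum-map-const : (f : A → ℕ) {v : ℕ} (xs : List A) → (∀ {x} → x ∈ₗ xs → f x ≡ v) →
                  sum (map f xs) ≡ length xs * v
  sum-map-const f []       f≡v = refl
  sum-map-const f (x ∷ xs) f≡v = cong₂ _+_ (f≡v (here refl)) (sum-map-const f xs (f≡v ∘ there))

  foldr-⊔-lub : (f : A → ℕ) {c : ℕ} (xs : List A) → (∀ {x} → x ∈ₗ xs → f x ≤ c) →
                foldr _⊔_ 0 (map f xs) ≤ c
  foldr-⊔-lub f []       f≤c = z≤n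
  foldr-⊔-lub f (x ∷ xs) f≤c = ⊔-lub (f≤c (here refl)) (foldr-⊔-lub f xs (f≤c ∘ there))

  foldr-⊔-upper : (f : A → ℕ) {x : A} {xs : List A} → x ∈ₗ xs → f x ≤ foldr _⊔_ 0 (map f xs)
  foldr-⊔-upper f {xs = y ∷ _}  (here refl) = m≤m⊔n (f y) _
  foldr-⊔-upper f {xs = y ∷ xs} (there x∈) = ≤-trans (foldr-⊔-upper f x∈) (m≤n⊔m (f y) _)

module _ {A : Set} {P : Pred A 0ℓ} (P? : Decidable P) (f : ℕ → A) (n : ℕ) where

  count-applyUpTo : ∀ {Q : Pred ℕ 0ℓ} (Q? : Decidable Q) →
                    (∀ {i} → i < n → P (f i) → Q i) → (∀ {i} → i < n → Q i → P (f i)) →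
                    count P? (applyUpTo f n) ≡ count Q? (upTo n)
  count-applyUpTo Q? P⇒Q Q⇒P = trans (cong (count P?) (sym (map-upTo f n)))
    (trans (count-map P? f (upTo n)) (count-≐ (P? ∘ f) Q? (upTo n) (P⇒Q ∘ ∈-upTo⁻) (Q⇒P ∘ ∈-upTo⁻)))

  count-applyUpTo-all : (∀ {i} → i < n → P (f i)) → count P? (applyUpTo f n) ≡ n
  count-applyUpTo-all Pf = trans (count-all P? (All.tabulate lemma)) (length-applyUpTo f n)
    where
      lemma : ∀ {x} → x ∈ₗ applyUpTo f n → P x
      lemma x∈ with _ , i<n , refl ← ∈-applyUpTo⁻ f x∈ = Pf i<n

  count-applyUpTo-none : (∀ {i} → i < n → ¬ P (f i)) → count P? (applyUpTo f n) ≡ 0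
  count-applyUpTo-none ¬Pf = count-none P? (All.tabulate lemma)
    where
      lemma : ∀ {x} → x ∈ₗ applyUpTo f n → ¬ P x
      lemma x∈ with _ , i<n , refl ← ∈-applyUpTo⁻ f x∈ = ¬Pf i<n

applyUpTo-+ : ∀ {A : Set} (f : ℕ → A) a b → applyUpTo f (a + b) ≡ applyUpTo f a ++ applyUpTo (f ∘ (a +_)) b
applyUpTo-+ f zero    b = refl
applyUpTo-+ f (suc a) b = cong (f 0 ∷_) (applyUpTo-+ (f ∘ suc) a b)

module _ (p : ℕ) .{{_ : NonZero p}} where

  count-residue : ∀ t {c} → c < p → count (λ k → k % p ≟ c) (upTo (t * p)) ≡ t
  count-residue zero    c<p = refl
  count-residue (suc t) {c} c<p = begin
    count P? (upTo (p + t * p))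
      ≡⟨ cong (count P?) (applyUpTo-+ (λ k → k) p (t * p)) ⟩
    count P? (upTo p ++ applyUpTo (p +_) (t * p))
      ≡⟨ count-++ P? (upTo p) _ ⟩
    count P? (upTo p) + count P? (applyUpTo (p +_) (t * p))
      ≡⟨ cong₂ _+_ first-block (cong (count P?) (sym (map-upTo (p +_) (t * p)))) ⟩
    1 + count P? (map (p +_) (upTo (t * p)))
      ≡⟨ cong suc (count-map P? (p +_) (upTo (t * p))) ⟩
    1 + count (P? ∘ (p +_)) (upTo (t * p))
      ≡⟨ cong suc (count-≐ (P? ∘ (p +_)) P? (upTo (t * p)) (λ _ → trans (sym (shift _))) (λ _ → trans (shift _))) ⟩
    1 + count P? (upTo (t * p))
      ≡⟨ cong suc (count-residue t c<p) ⟩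
    suc t ∎
    where
      open ≡-Reasoning
      P? = λ k → k % p ≟ c
      shift : ∀ k → (p + k) % p ≡ k % p
      shift k = %-remove-+ˡ k ∣-refl
      first-block : count P? (upTo p) ≡ 1
      first-block = trans
        (count-≐ P? (_≟ c) (upTo p) (λ k∈ → trans (sym (m<n⇒m%n≡m (∈-upTo⁻ k∈))))
                                    (λ k∈ → trans (m<n⇒m%n≡m (∈-upTo⁻ k∈))))
        (count-≟-unique _≟_ (Unique.upTo⁺ p) (∈-upTo⁺ c<p))

module _ (d : ℕ) .{{_ : NonZero d}} where

  +-cong-% : ∀ {x x′ y y′} → x % d ≡ x′ % d → y % d ≡ y′ % d → (x + y) % d ≡ (x′ + y′) % d
  +-cong-% {x} {x′} {y} {y′} x≡x′ y≡y′ = begin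
    (x + y) % d             ≡⟨ %-distribˡ-+ x y d ⟩
    (x % d + y % d) % d     ≡⟨ cong₂ (λ u v → (u + v) % d) x≡x′ y≡y′ ⟩
    (x′ % d + y′ % d) % d   ≡⟨ %-distribˡ-+ x′ y′ d ⟨
    (x′ + y′) % d           ∎
    where open ≡-Reasoning

  0%n≡0 : 0 % d ≡ 0
  0%n≡0 = m<n⇒m%n≡m (>-nonZero⁻¹ d)

module Residues (m : ℕ) (d : ℕ) .{{_ : NonZero d}} (d∣N : d ∣ suc m) where
  open Dihedral m

  toℕ-⊕ : ∀ a b → toℕ (a ⊕ b) % d ≡ (toℕ a + toℕ b) % d
  toℕ-⊕ a b = trans (cong (_% d) (toℕ-fromℕ< _)) (m∣n⇒o%n%m≡o%m d N _ d∣N)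

  toℕ-⊖ : ∀ a → toℕ (⊖ a) % d ≡ (N ∸ toℕ a) % d
  toℕ-⊖ a = trans (cong (_% d) (toℕ-fromℕ< _)) (m∣n⇒o%n%m≡o%m d N _ d∣N)

  ⊖-+-% : ∀ a → (toℕ (⊖ a) + toℕ a) % d ≡ 0
  ⊖-+-% a = begin
    (toℕ (⊖ a) + toℕ a) % d   ≡⟨ +-cong-% d (toℕ-⊖ a) refl ⟩
    (N ∸ toℕ a + toℕ a) % d   ≡⟨ cong (_% d) (m∸n+n≡m (<⇒≤ (toℕ<n a))) ⟩
    N % d                     ≡⟨ n∣m⇒m%n≡0 N d d∣N ⟩
    0                         ∎
    where open ≡-Reasoning

  ⊕-%ʳ : ∀ a b → toℕ b % d ≡ 0 → toℕ (a ⊕ b) % d ≡ toℕ a % d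
  ⊕-%ʳ a b b≡0 = trans (toℕ-⊕ a b)
    (trans (+-cong-% d refl (trans b≡0 (sym (0%n≡0 d)))) (cong (_% d) (+-identityʳ (toℕ a))))

  ⊕-%ˡ : ∀ a b → toℕ a % d ≡ 0 → toℕ (a ⊕ b) % d ≡ toℕ b % d
  ⊕-%ˡ a b a≡0 = trans (toℕ-⊕ a b) (+-cong-% d (trans a≡0 (sym (0%n≡0 d))) refl)

  ⊖-% : ∀ a → toℕ a % d ≡ 0 → toℕ (⊖ a) % d ≡ 0
  ⊖-% a a≡0 = begin
    toℕ (⊖ a) % d             ≡⟨ cong (_% d) (+-identityʳ (toℕ (⊖ a))) ⟨
    (toℕ (⊖ a) + 0) % d       ≡⟨ +-cong-% d refl (trans a≡0 (sym (0%n≡0 d))) ⟨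
    (toℕ (⊖ a) + toℕ a) % d   ≡⟨ ⊖-+-% a ⟩
    0                         ∎
    where open ≡-Reasoning

  ⊕⊖-+-% : ∀ a b → (toℕ (a ⊕ (⊖ b)) + toℕ b) % d ≡ toℕ a % d
  ⊕⊖-+-% a b = begin
    (toℕ (a ⊕ (⊖ b)) + toℕ b) % d       ≡⟨ +-cong-% d (toℕ-⊕ a (⊖ b)) refl ⟩
    (toℕ a + toℕ (⊖ b) + toℕ b) % d     ≡⟨ cong (_% d) (+-assoc (toℕ a) _ _) ⟩
    (toℕ a + (toℕ (⊖ b) + toℕ b)) % d   ≡⟨ +-cong-% d refl (trans (⊖-+-% b) (sym (0%n≡0 d))) ⟩
    (toℕ a + 0) % d                     ≡⟨ cong (_% d) (+-identityʳ (toℕ a)) ⟩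
    toℕ a % d                           ∎
    where open ≡-Reasoning

  ⊕⊖-%-zero⇒ : ∀ a b → toℕ (a ⊕ (⊖ b)) % d ≡ 0 → toℕ a % d ≡ toℕ b % d
  ⊕⊖-%-zero⇒ a b a-b≡0 = trans (sym (⊕⊖-+-% a b)) (+-cong-% d (trans a-b≡0 (sym (0%n≡0 d))) refl)

  ⊕⊖-%-zero⇐ : ∀ a b → toℕ a % d ≡ toℕ b % d → toℕ (a ⊕ (⊖ b)) % d ≡ 0
  ⊕⊖-%-zero⇐ a b a≡b = begin
    toℕ (a ⊕ (⊖ b)) % d         ≡⟨ toℕ-⊕ a (⊖ b) ⟩
    (toℕ a + toℕ (⊖ b)) % d     ≡⟨ +-cong-% d a≡b refl ⟩
    (toℕ b + toℕ (⊖ b)) % d     ≡⟨ cong (_% d) (+-comm (toℕ b) _) ⟩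
    (toℕ (⊖ b) + toℕ b) % d     ≡⟨ ⊖-+-% b ⟩
    0                           ∎
    where open ≡-Reasoning

  ⊖-%⁻¹ : ∀ u r → (toℕ u + r) % d ≡ 0 → toℕ (⊖ u) % d ≡ r % d
  ⊖-%⁻¹ u r u+r≡0 = begin
    toℕ (⊖ u) % d                     ≡⟨ cong (_% d) (+-identityʳ (toℕ (⊖ u))) ⟨
    (toℕ (⊖ u) + 0) % d               ≡⟨ +-cong-% d refl (trans u+r≡0 (sym (0%n≡0 d))) ⟨
    (toℕ (⊖ u) + (toℕ u + r)) % d     ≡⟨ cong (_% d) (+-assoc (toℕ (⊖ u)) _ _) ⟨
    (toℕ (⊖ u) + toℕ u + r) % d       ≡⟨ +-cong-% d (trans (⊖-+-% u) (sym (0%n≡0 d))) refl ⟩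
    r % d                             ∎
    where open ≡-Reasoning

module _ (m : ℕ) where
  open Dihedral m
  open Residues m N ∣-refl

  toℕ%N : ∀ (a : Fin N) → toℕ a % N ≡ toℕ a
  toℕ%N a = m<n⇒m%n≡m (toℕ<n a)

  ⊕⊖-⊕ : ∀ a b → (a ⊕ (⊖ b)) ⊕ b ≡ a
  ⊕⊖-⊕ a b = toℕ-injective (begin
    toℕ ((a ⊕ (⊖ b)) ⊕ b)               ≡⟨ toℕ%N _ ⟨
    toℕ ((a ⊕ (⊖ b)) ⊕ b) % N           ≡⟨ toℕ-⊕ (a ⊕ (⊖ b)) b ⟩
    (toℕ (a ⊕ (⊖ b)) + toℕ b) % N       ≡⟨ ⊕⊖-+-% a b ⟩
    toℕ a % N                           ≡⟨ toℕ%N a ⟩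
    toℕ a                               ∎)
    where open ≡-Reasoning

module Walks (m : ℕ) where
  open Dihedral m

  module Search {P : Pred ℕ 0ℓ} (P? : Decidable P) where

    search-≤ : ∀ fuel start {c} → start ≤ c → c < start + fuel → P c → search P? fuel start ≤ c
    search-≤ zero    start s≤c c<s+0 _ = contradiction (≤-trans c<s+0 (≤-reflexive (+-identityʳ start))) (≤⇒≯ s≤c)
    search-≤ (suc f) start s≤c c<s+f pc with P? start
    ... | yes _ = s≤c
    ... | no ¬ps with m≤n⇒m<n∨m≡n s≤c
    ...   | inj₂ refl = contradiction pc ¬ps
    ...   | inj₁ s<c  = search-≤ f (suc start) s<c (≤-trans c<s+f (≤-reflexive (+-suc start f))) pc

    ≤-search : ∀ fuel start {c} → c ≤ start + fuel → (∀ {k} → k < c → ¬ P k) → c ≤ search P? fuel start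
    ≤-search zero    start c≤s+0 _ = ≤-trans c≤s+0 (≤-reflexive (+-identityʳ start))
    ≤-search (suc f) start c≤s+f ¬P with P? start
    ... | yes ps = ≮⇒≥ (λ s<c → ¬P s<c ps)
    ... | no _   = ≤-search f (suc start) (≤-trans c≤s+f (≤-reflexive (+-suc start f))) ¬P

  Reach-step : ∀ {k H W K} → Reach k H W → W ∈ₗ V → Adj W K → Reach (suc k) H K
  Reach-step r W∈V adj = inj₂ (lose W∈V (r , adj))

  Reach-trans : ∀ {a H W} b {K} → Reach a H W → Reach b W K → Reach (b + a) H K
  Reach-trans zero    r refl = r
  Reach-trans (suc b) r (inj₁ r′) = inj₁ (Reach-trans b r r′)
  Reach-trans {a} {H} {W} (suc b) {K} r (inj₂ any) = via (find any)
    where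
      via : Σ SubG (λ W′ → W′ ∈ₗ V × Reach b W W′ × Adj W′ K) → Reach (suc b + a) H K
      via (W′ , W′∈V , r′ , adj) = Reach-step (Reach-trans b r r′) W′∈V adj

  Reach-mono : ∀ {k l H K} → k ≤ l → Reach k H K → Reach l H K
  Reach-mono = mono ∘ ≤⇒≤′
    where
      mono : ∀ {k l H K} → k ≤′ l → Reach k H K → Reach l H K
      mono ≤′-refl       r = r
      mono (≤′-step k≤l) r = inj₁ (mono k≤l r)

  Reach-1⇒ : ∀ {H K} → Reach 1 H K → H ≡ K ⊎ Adj H K
  Reach-1⇒ (inj₁ H≡K) = inj₁ H≡K
  Reach-1⇒ {H} {K} (inj₂ any) = via (find any)
    where
      via : Σ SubG (λ W → W ∈ₗ V × H ≡ W × Adj W K) → H ≡ K ⊎ Adj H K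
      via (_ , _ , refl , adj) = inj₂ adj

  dist-≤ : ∀ {H K c} → c < length V → Reach c H K → dist H K ≤ c
  dist-≤ {H} {K} c<V r = Search.search-≤ (λ k → reach? k H K) (length V) 0 z≤n c<V r

  dist-> : ∀ {H K c} → c < length V → ¬ Reach c H K → c < dist H K
  dist-> {H} {K} c<V ¬r = Search.≤-search (λ k → reach? k H K) (length V) 0 c<V
    (λ k<1+c r → ¬r (Reach-mono (≤-pred k<1+c) r))

  ecc-≡ : ∀ {H c} K₀ → suc c < length V → (∀ {K} → K ∈ₗ V → Reach (suc c) H K) →
          K₀ ∈ₗ V → ¬ Reach c H K₀ → ecc H ≡ suc c
  ecc-≡ {H} K₀ c<V reach K₀∈V ¬r = ≤-antisym
    (foldr-⊔-lub (dist H) V (λ K∈V → dist-≤ c<V (reach K∈V)))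
    (≤-trans (dist-> (<-trans (n<1+n _) c<V) ¬r) (foldr-⊔-upper (dist H) K₀∈V))

  -- Opaque because unfolding deg makes Agda evaluate the enumeration V of all subsets.
  opaque
    weight : SubG → ℕ
    weight H = deg H * ecc H

    weight-≡ : ∀ H → weight H ≡ deg H * ecc H
    weight-≡ H = refl

  module _ {L : List SubG} (V↭L : V ↭ L) where

    length-V : length V ≡ length L
    length-V = ↭-length V↭L

    deg-↭ : ∀ H → deg H ≡ count (adj? H) L
    deg-↭ H = ↭-length (filter-↭ (adj? H) V↭L)

    opaque
      unfolding weight

      ξc-↭ : ξc ≡ sum (map weight L)
      ξc-↭ = sum-↭ (map⁺ weight V↭L)

module Enumeration (m : ℕ) where
  open Dihedral m

  ∈-allSubsets : ∀ k (v : Subset k) → v ∈ₗ allSubsets k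
  ∈-allSubsets zero    []            = here refl
  ∈-allSubsets (suc k) (true  ∷ v) = ∈-++⁺ˡ (∈-map⁺ (inside ∷_) (∈-allSubsets k v))
  ∈-allSubsets (suc k) (false ∷ v) = ∈-++⁺ʳ _ (∈-map⁺ (outside ∷_) (∈-allSubsets k v))

  allSubsets-unique : ∀ k → Unique (allSubsets k)
  allSubsets-unique zero    = All.[] ∷ []
  allSubsets-unique (suc k) = Unique.++⁺
    (Unique.map⁺ ∷-injectiveʳ (allSubsets-unique k))
    (Unique.map⁺ ∷-injectiveʳ (allSubsets-unique k))
    heads-differ
    where
      heads-differ : ∀ {v} → ¬ (v ∈ₗ map (inside ∷_) (allSubsets k) × v ∈ₗ map (outside ∷_) (allSubsets k))
      heads-differ (v∈ , v∈′) with ∈-map⁻ (inside ∷_) v∈ | ∈-map⁻ (outside ∷_) v∈′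
      ... | _ , _ , refl | _ , _ , ()

  V-unique : Unique V
  V-unique = Unique.filter⁺ isVertex? (Unique.cartesianProduct⁺ (allSubsets-unique N) (allSubsets-unique N))

  ∈V⁺ : ∀ {H} → IsVertex H → H ∈ₗ V
  ∈V⁺ {R , S} = ∈-filter⁺ isVertex? (∈-cartesianProduct⁺ (∈-allSubsets N R) (∈-allSubsets N S))

  ∈V⁻ : ∀ {H} → H ∈ₗ V → IsVertex H
  ∈V⁻ = proj₂ ∘ ∈-filter⁻ isVertex? {xs = allSubG}

-- The subgroups ⟨rᵈ⟩ and ⟨rᵈ, rᶜs⟩

module Subgroups (m : ℕ) where
  open Dihedral m

  ⟦_⟧ : {P : Pred ℕ 0ℓ} → Decidable P → Subset N
  ⟦ P? ⟧ = tabulate (λ j → does (P? (toℕ j)))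

  module _ {P : Pred ℕ 0ℓ} (P? : Decidable P) where

    ∈⟦⟧⁺ : ∀ {j} → P (toℕ j) → j ∈ ⟦ P? ⟧
    ∈⟦⟧⁺ {j} pj = lookup⇒[]= j _ (trans (lookup∘tabulate (λ i → does (P? (toℕ i))) j) (dec-true (P? (toℕ j)) pj))

    ∈⟦⟧⁻ : ∀ {j} → j ∈ ⟦ P? ⟧ → P (toℕ j)
    ∈⟦⟧⁻ {j} j∈ with P? (toℕ j) | trans (sym (lookup∘tabulate (λ i → does (P? (toℕ i))) j)) ([]=⇒lookup j∈)
    ... | yes pj | _  = pj
    ... | no  _  | ()

  -- Opaque, so that d and c are recovered by unification from a membership goal.
  opaque
    Class : (d : ℕ) .{{_ : NonZero d}} → ℕ → Subset N
    Class d c = ⟦ (λ j → j % d ≟ c) ⟧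

  -- A pair (R , S) stands for {rʲ : j ∈ R} ∪ {rʲs : j ∈ S}; thus ⟨r^ N ,r^ k s⟩ = {1, rᵏs}.
  ⟨r^_⟩ : (d : ℕ) .{{_ : NonZero d}} → SubG
  ⟨r^ d ⟩ = Class d 0 , ∅

  ⟨r^_,r^_s⟩ : (d : ℕ) .{{_ : NonZero d}} → ℕ → SubG
  ⟨r^ d ,r^ c s⟩ = Class d 0 , Class d c

  opaque
    unfolding Class

    ∈Class⁺ : ∀ {d} .{{_ : NonZero d}} {c j} → toℕ j % d ≡ c → j ∈ Class d c
    ∈Class⁺ {d} {c} = ∈⟦⟧⁺ (λ j → j % d ≟ c)

    ∈Class⁻ : ∀ {d} .{{_ : NonZero d}} {c j} → j ∈ Class d c → toℕ j % d ≡ c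
    ∈Class⁻ {d} {c} = ∈⟦⟧⁻ (λ j → j % d ≟ c)

  module _ (d : ℕ) .{{_ : NonZero d}} (d∣N : d ∣ N) where
    open Residues m d d∣N

    private
      ⊕-closed : ∀ a b → a ∈ Class d 0 → b ∈ Class d 0 → (a ⊕ b) ∈ Class d 0
      ⊕-closed a b a∈ b∈ = ∈Class⁺ (trans (⊕-%ʳ a b (∈Class⁻ b∈)) (∈Class⁻ a∈))

      ⊖-closed : ∀ a → a ∈ Class d 0 → (⊖ a) ∈ Class d 0
      ⊖-closed a a∈ = ∈Class⁺ (⊖-% a (∈Class⁻ a∈))

      0∈Class : Fin.zero ∈ Class d 0
      0∈Class = ∈Class⁺ (0%n≡0 d)

    ⟨r^d⟩-isSubgroup : IsSubgroup ⟨r^ d ⟩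
    ⟨r^d⟩-isSubgroup = 0∈Class , closed , inv-closed
      where
        closed : ∀ x y → x ∈G ⟨r^ d ⟩ → y ∈G ⟨r^ d ⟩ → (x · y) ∈G ⟨r^ d ⟩
        closed (a , false) (b , false) a∈ b∈ = ⊕-closed a b a∈ b∈
        closed (a , false) (b , true)  a∈ b∈ = contradiction b∈ ∉⊥
        closed (a , true)  (b , _)     a∈ b∈ = contradiction a∈ ∉⊥
        inv-closed : ∀ x → x ∈G ⟨r^ d ⟩ → inv x ∈G ⟨r^ d ⟩
        inv-closed (a , false) a∈ = ⊖-closed a a∈
        inv-closed (a , true)  a∈ = a∈

    ⟨r^d,r^cs⟩-isSubgroup : ∀ c → IsSubgroup ⟨r^ d ,r^ c s⟩
    ⟨r^d,r^cs⟩-isSubgroup c = 0∈Class , closed , inv-closed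
      where
        closed : ∀ x y → x ∈G ⟨r^ d ,r^ c s⟩ → y ∈G ⟨r^ d ,r^ c s⟩ → (x · y) ∈G ⟨r^ d ,r^ c s⟩
        closed (a , false) (b , false) a∈ b∈ = ⊕-closed a b a∈ b∈
        closed (a , false) (b , true)  a∈ b∈ = ∈Class⁺ (trans (⊕-%ˡ a b (∈Class⁻ a∈)) (∈Class⁻ b∈))
        closed (a , true)  (b , false) a∈ b∈ =
          ∈Class⁺ (trans (⊕-%ʳ a (⊖ b) (⊖-% b (∈Class⁻ b∈))) (∈Class⁻ a∈))
        closed (a , true)  (b , true)  a∈ b∈ =
          ∈Class⁺ (⊕⊖-%-zero⇐ a b (trans (∈Class⁻ a∈) (sym (∈Class⁻ b∈))))
        inv-closed : ∀ x → x ∈G ⟨r^ d ,r^ c s⟩ → inv x ∈G ⟨r^ d ,r^ c s⟩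
        inv-closed (a , false) a∈ = ⊖-closed a a∈
        inv-closed (a , true)  a∈ = a∈

    reflections-coset : ∀ {R S} → IsSubgroup (R , S) → R ≡ Class d 0 →
                        ∀ {s} → s ∈ S → S ≡ Class d (toℕ s % d)
    reflections-coset {S = S} (_ , closed , _) refl {s} s∈S = ⊆-antisym
      (λ {j} j∈S → ∈Class⁺ (⊕⊖-%-zero⇒ j s (∈Class⁻ (closed (j , true) (s , true) j∈S s∈S))))
      (λ {j} j∈ → subst (_∈ S) (⊕⊖-⊕ m j s)
        (closed (j ⊕ (⊖ s) , false) (s , true) (∈Class⁺ (⊕⊖-%-zero⇐ j s (∈Class⁻ j∈))) s∈S))

Bézout-scale : ∀ {a b} k → Bézout.Identity 1 a b → Bézout.Identity k (a * k) (b * k)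
Bézout-scale {a} {b} k (Bézout.+- x y eq) = Bézout.+- x y (begin
  k + y * (b * k)   ≡⟨ cong (k +_) (*-assoc y b k) ⟨
  (1 + y * b) * k   ≡⟨ cong (_* k) eq ⟩
  x * a * k         ≡⟨ *-assoc x a k ⟩
  x * (a * k)       ∎)
  where open ≡-Reasoning
Bézout-scale {a} {b} k (Bézout.-+ x y eq) = Bézout.-+ x y (begin
  k + x * (a * k)   ≡⟨ cong (k +_) (*-assoc x a k) ⟨
  (1 + x * a) * k   ≡⟨ cong (_* k) eq ⟩
  y * b * k         ≡⟨ *-assoc y b k ⟩
  y * (b * k)       ∎)
  where open ≡-Reasoning

ξc-arithmetic : ∀ p → suc p * 2 + (suc p * 2 + (p * (suc (p + p) * 2) + p * p * (1 * 3)))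
                      ≡ 7 * (p * (p * 1)) + 6 * p + 4
ξc-arithmetic = solve-∀

-- The intersection graph of D_{2p²}

module PrimeSquare (q : ℕ) (prime : Prime (2 + q)) where

  p : ℕ
  p = 2 + q

  m : ℕ
  m = pred (p * p)

  open Dihedral m public
  open Subgroups m public
  open Enumeration m
  open Walks m

  p∣N : p ∣ N
  p∣N = divides p refl

  1<N : 1 < N
  1<N = s≤s (s≤s z≤n)

  p<N : p < N
  p<N = m<m*n p p (s≤s (s≤s z≤n))

  coprime-N : ∀ {x} → x % p ≢ 0 → Coprime x N
  coprime-N {x} x≢0 {i} (i∣x , i∣N) with prime⇒irreducible prime (gcd[m,n]∣n i p)
  ... | inj₂ gcd≡p = contradiction (n∣m⇒m%n≡0 x p (∣-trans (subst (_∣ i) gcd≡p (gcd[m,n]∣m i p)) i∣x)) x≢0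
  ... | inj₁ gcd≡1 with prime⇒irreducible prime (coprime-divisor (gcd≡1⇒coprime gcd≡1) i∣N)
  ...   | inj₁ i≡1 = i≡1
  ...   | inj₂ i≡p = contradiction (n∣m⇒m%n≡0 x p (subst (_∣ x) i≡p i∣x)) x≢0

  multiple-of-p-Bézout : ∀ {y} → y ≢ 0 → y < N → y % p ≡ 0 → Bézout.Identity p y N
  multiple-of-p-Bézout {y} y≢0 y<N y%p≡0 = subst (λ z → Bézout.Identity p z N) j*p≡y
    (Bézout-scale p (Bézout.Identity.sym (coprime-Bézout (prime⇒coprime prime {{≢-nonZero j≢0}} j<p))))
    where
      j = y / p
      j*p≡y : j * p ≡ y
      j*p≡y = m/n*n≡m (m%n≡0⇒n∣m y p y%p≡0)
      j≢0 : j ≢ 0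
      j≢0 j≡0 = y≢0 (trans (sym j*p≡y) (cong (_* p) j≡0))
      j<p : j < p
      j<p = m<n*o⇒m/o<n {y} {p} {p} y<N

  module Rotations (R : Subset N) (0∈R : Fin.zero ∈ R)
                   (⊕-closed : ∀ {a b} → a ∈ R → b ∈ R → (a ⊕ b) ∈ R)
                   (⊖-closed : ∀ {a} → a ∈ R → (⊖ a) ∈ R) where
    open Residues m N ∣-refl

    _×ᶠ_ : ℕ → Fin N → Fin N
    zero  ×ᶠ x = Fin.zero
    suc t ×ᶠ x = x ⊕ (t ×ᶠ x)

    toℕ-×ᶠ : ∀ t x → toℕ (t ×ᶠ x) ≡ (t * toℕ x) % N
    toℕ-×ᶠ zero    x = refl
    toℕ-×ᶠ (suc t) x = begin
      toℕ (x ⊕ (t ×ᶠ x))               ≡⟨ toℕ-fromℕ< _ ⟩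
      (toℕ x + toℕ (t ×ᶠ x)) % N       ≡⟨ cong (λ z → (toℕ x + z) % N) (toℕ-×ᶠ t x) ⟩
      (toℕ x + t * toℕ x % N) % N      ≡⟨ +-cong-% N {toℕ x} {toℕ x} {t * toℕ x % N} {t * toℕ x}
                                            refl (m%n%n≡m%n (t * toℕ x) N) ⟩
      (toℕ x + t * toℕ x) % N          ∎
      where open ≡-Reasoning

    ×ᶠ-closed : ∀ t {x} → x ∈ R → (t ×ᶠ x) ∈ R
    ×ᶠ-closed zero    x∈R = 0∈R
    ×ᶠ-closed (suc t) x∈R = ⊕-closed x∈R (×ᶠ-closed t x∈R)

    Attains : ℕ → Set
    Attains r = Σ (Fin N) λ v → v ∈ R × toℕ v ≡ r

    attains-Bézout : ∀ {x r} → x ∈ R → Bézout.Identity r (toℕ x) N → r < N → Attains r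
    attains-Bézout {x} {r} x∈R (Bézout.+- a y eq) r<N = a ×ᶠ x , ×ᶠ-closed a x∈R , (begin
      toℕ (a ×ᶠ x)       ≡⟨ toℕ-×ᶠ a x ⟩
      (a * toℕ x) % N    ≡⟨ cong (_% N) eq ⟨
      (r + y * N) % N    ≡⟨ [m+kn]%n≡m%n r y N ⟩
      r % N              ≡⟨ m<n⇒m%n≡m r<N ⟩
      r                  ∎)
      where open ≡-Reasoning
    -- Here a·x ≡ -r, so r is reached by negating a·x.
    attains-Bézout {x} {r} x∈R (Bézout.-+ a y eq) r<N =
      ⊖ (a ×ᶠ x) , ⊖-closed (×ᶠ-closed a x∈R) , (begin
      toℕ (⊖ (a ×ᶠ x))        ≡⟨ toℕ%N m _ ⟨
      toℕ (⊖ (a ×ᶠ x)) % N    ≡⟨ ⊖-%⁻¹ (a ×ᶠ x) r ax+r≡0 ⟩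
      r % N                   ≡⟨ m<n⇒m%n≡m r<N ⟩
      r                       ∎)
      where
        open ≡-Reasoning
        ax+r≡0 : (toℕ (a ×ᶠ x) + r) % N ≡ 0
        ax+r≡0 = begin
          (toℕ (a ×ᶠ x) + r) % N   ≡⟨ +-cong-% N {toℕ (a ×ᶠ x)} {a * toℕ x} {r} {r}
                                        (trans (cong (_% N) (toℕ-×ᶠ a x)) (m%n%n≡m%n (a * toℕ x) N)) refl ⟩
          (a * toℕ x + r) % N      ≡⟨ cong (_% N) (trans (+-comm _ r) eq) ⟩
          (y * N) % N              ≡⟨ m*n%n≡0 y N ⟩
          0                        ∎

    Class⊆R : ∀ d .{{_ : NonZero d}} → Attains d → Class d 0 ⊆ R
    Class⊆R d (v , v∈R , v≡d) {j} j∈ = subst (_∈ R) (toℕ-injective (begin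
      toℕ ((toℕ j / d) ×ᶠ v)    ≡⟨ toℕ-×ᶠ (toℕ j / d) v ⟩
      (toℕ j / d * toℕ v) % N   ≡⟨ cong (λ t → (toℕ j / d * t) % N) v≡d ⟩
      (toℕ j / d * d) % N       ≡⟨ cong (_% N) (m/n*n≡m (m%n≡0⇒n∣m (toℕ j) d (∈Class⁻ j∈))) ⟩
      toℕ j % N                 ≡⟨ toℕ%N m j ⟩
      toℕ j                     ∎)) (×ᶠ-closed (toℕ j / d) v∈R)
      where open ≡-Reasoning

    R⊆Class : ∀ d .{{_ : NonZero d}} → (∀ {x} → x ∈ R → toℕ x % d ≡ 0) → R ⊆ Class d 0
    R⊆Class d R≡0 x∈R = ∈Class⁺ (R≡0 x∈R)

    rotations-classification : R ≡ Class 1 0 ⊎ R ≡ Class p 0 ⊎ R ≡ Class N 0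
    rotations-classification with any? (λ x → (x ∈ˢ? R) ×-dec ¬? (toℕ x % p ≟ 0))
    ... | yes (x , x∈R , x≢0) = inj₁ (⊆-antisym (R⊆Class 1 (λ {y} _ → n%1≡0 (toℕ y)))
          (Class⊆R 1 (attains-Bézout x∈R (coprime-Bézout (coprime-N x≢0)) 1<N)))
    ... | no ¬unit with any? (λ x → (x ∈ˢ? R) ×-dec ¬? (toℕ x ≟ 0))
    ...   | yes (x , x∈R , x≢0) = inj₂ (inj₁ (⊆-antisym (R⊆Class p multiple-of-p)
            (Class⊆R p (attains-Bézout x∈R (multiple-of-p-Bézout x≢0 (toℕ<n x) (multiple-of-p x∈R)) p<N))))
      where
        multiple-of-p : ∀ {y} → y ∈ R → toℕ y % p ≡ 0
        multiple-of-p {y} y∈R with toℕ y % p ≟ 0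
        ... | yes y≡0 = y≡0
        ... | no  y≢0 = contradiction (y , y∈R , y≢0) ¬unit
    ...   | no ¬nonzero = inj₂ (inj₂ (⊆-antisym (R⊆Class N zero-only)
            (λ {j} j∈ → subst (_∈ R) (toℕ-injective (sym (trans (sym (toℕ%N m j)) (∈Class⁻ j∈)))) 0∈R)))
      where
        zero-only : ∀ {y} → y ∈ R → toℕ y % N ≡ 0
        zero-only {y} y∈R with toℕ y ≟ 0
        ... | yes y≡0 = trans (toℕ%N m y) y≡0
        ... | no  y≢0 = contradiction (y , y∈R , y≢0) ¬nonzero

  data Canonical : SubG → Set where
    rotations   : Canonical ⟨r^ 1 ⟩
    p-rotations : Canonical ⟨r^ p ⟩
    dihedral    : ∀ {c} → c < p → Canonical ⟨r^ p ,r^ c s⟩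
    reflection  : ∀ {k} → k < N → Canonical ⟨r^ N ,r^ k s⟩

  module _ {d : ℕ} .{{_ : NonZero d}} where

    fromℕ<-∈Class : ∀ {k} (k<N : k < N) → fromℕ< k<N ∈ Class d (k % d)
    fromℕ<-∈Class k<N = ∈Class⁺ (cong (_% d) (toℕ-fromℕ< k<N))

    fromℕ<-∈Class′ : ∀ {k} (k<N : k < N) → k < d → fromℕ< k<N ∈ Class d k
    fromℕ<-∈Class′ k<N k<d = subst (fromℕ< k<N ∈_) (cong (Class d) (m<n⇒m%n≡m k<d)) (fromℕ<-∈Class k<N)

    fromℕ<-∉Class : ∀ {k c} (k<N : k < N) → k % d ≢ c → fromℕ< k<N ∉ Class d c
    fromℕ<-∉Class k<N k≢c k∈ = k≢c (trans (cong (_% d) (sym (toℕ-fromℕ< k<N))) (∈Class⁻ k∈))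

  1<p : 1 < p
  1<p = s≤s (s≤s z≤n)

  rᵖ : G
  rᵖ = fromℕ< p<N , false

  r¹ : G
  r¹ = fromℕ< 1<N , false

  rᵏs : ∀ {k} → k < N → G
  rᵏs k<N = fromℕ< k<N , true

  rᵖ≢e : rᵖ ≢ e
  rᵖ≢e rᵖ≡e = 1+n≢0 (trans (sym (toℕ-fromℕ< p<N)) (cong (toℕ ∘ proj₁) rᵖ≡e))

  rᵖ∈⟨r^1⟩ : rᵖ ∈G ⟨r^ 1 ⟩
  rᵖ∈⟨r^1⟩ = ∈Class⁺ (n%1≡0 (toℕ (fromℕ< p<N)))

  rᵖ∈⟨r^p⟩ : rᵖ ∈G ⟨r^ p ⟩
  rᵖ∈⟨r^p⟩ = ∈Class⁺ (trans (cong (_% p) (toℕ-fromℕ< p<N)) (n%n≡0 p))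

  r¹∉⟨r^d⟩ : ∀ {d} .{{_ : NonZero d}} → 1 < d → ¬ (r¹ ∈G ⟨r^ d ⟩)
  r¹∉⟨r^d⟩ 1<d = fromℕ<-∉Class 1<N (λ 1≡0 → 1+n≢0 (trans (sym (m<n⇒m%n≡m 1<d)) 1≡0))

  rᵏs∈⟨r^N,r^ks⟩ : ∀ {k} (k<N : k < N) → rᵏs k<N ∈G ⟨r^ N ,r^ k s⟩
  rᵏs∈⟨r^N,r^ks⟩ k<N = fromℕ<-∈Class′ k<N k<N

  canonical⇒vertex : ∀ {H} → Canonical H → IsVertex H
  canonical⇒vertex rotations =
    ⟨r^d⟩-isSubgroup 1 (1∣ N) , (rᵖ , rᵖ≢e , rᵖ∈⟨r^1⟩) , ((Fin.zero , true) , ∉⊥)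
  canonical⇒vertex p-rotations =
    ⟨r^d⟩-isSubgroup p p∣N , (rᵖ , rᵖ≢e , rᵖ∈⟨r^p⟩) , ((Fin.zero , true) , ∉⊥)
  canonical⇒vertex (dihedral {c} _) =
    ⟨r^d,r^cs⟩-isSubgroup p p∣N c , (rᵖ , rᵖ≢e , rᵖ∈⟨r^p⟩) , (r¹ , r¹∉⟨r^d⟩ 1<p)
  canonical⇒vertex (reflection {k} k<N) =
    ⟨r^d,r^cs⟩-isSubgroup N ∣-refl k , (rᵏs k<N , (λ ()) , rᵏs∈⟨r^N,r^ks⟩ k<N) , (r¹ , r¹∉⟨r^d⟩ 1<N)

  vertex⇒canonical : ∀ {H} → IsVertex H → Canonical H
  vertex⇒canonical {R , S} (isSg@(0∈R , closed , inv-closed) , (x , x≢e , x∈H) , (y , y∉H))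
    with Rotations.rotations-classification R 0∈R (closed (_ , false) (_ , false)) (inv-closed (_ , false))
       | nonempty? S
  ... | inj₁ refl | yes (s , s∈S) = contradiction (everything y) y∉H
    where
      everything : ∀ z → z ∈G (R , S)
      everything (a , false) = ∈Class⁺ (n%1≡0 (toℕ a))
      everything (a , true)  = subst (a ∈_) (sym (reflections-coset 1 (1∣ N) isSg refl s∈S))
                                 (∈Class⁺ (trans (n%1≡0 (toℕ a)) (sym (n%1≡0 (toℕ s)))))
  ... | inj₁ refl        | no S≢∅ = subst Canonical (cong (R ,_) (sym (Empty-unique S≢∅))) rotations
  ... | inj₂ (inj₁ refl) | no S≢∅ = subst Canonical (cong (R ,_) (sym (Empty-unique S≢∅))) p-rotations
  ... | inj₂ (inj₂ refl) | no S≢∅ = contradiction (only-identity x x∈H) x≢e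
    where
      only-identity : ∀ z → z ∈G (R , S) → z ≡ e
      only-identity (a , false) a∈ = cong (_, false) (toℕ-injective (trans (sym (toℕ%N m a)) (∈Class⁻ a∈)))
      only-identity (a , true)  a∈ = contradiction (a , a∈) S≢∅
  ... | inj₂ (inj₁ refl) | yes (s , s∈S) = subst Canonical (cong (R ,_) (sym (reflections-coset p p∣N isSg refl s∈S)))
                                             (dihedral (m%n<n (toℕ s) p))
  ... | inj₂ (inj₂ refl) | yes (s , s∈S) = subst Canonical (cong (R ,_) (sym (reflections-coset N ∣-refl isSg refl s∈S)))
                                             (reflection (m%n<n (toℕ s) N))

  dihedrals : List SubG
  dihedrals = applyUpTo ⟨r^ p ,r^_s⟩ p

  reflections : List SubG
  reflections = applyUpTo ⟨r^ N ,r^_s⟩ N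

  canonicals : List SubG
  canonicals = ⟨r^ 1 ⟩ ∷ ⟨r^ p ⟩ ∷ dihedrals ++ reflections

  ∈-canonicals⁺ : ∀ {H} → Canonical H → H ∈ₗ canonicals
  ∈-canonicals⁺ rotations      = here refl
  ∈-canonicals⁺ p-rotations    = there (here refl)
  ∈-canonicals⁺ (dihedral c<p)   = there (there (∈-++⁺ˡ (∈-applyUpTo⁺ ⟨r^ p ,r^_s⟩ c<p)))
  ∈-canonicals⁺ (reflection k<N) = there (there (∈-++⁺ʳ dihedrals (∈-applyUpTo⁺ ⟨r^ N ,r^_s⟩ k<N)))

  ∈-dihedrals⁻ : ∀ {H} → H ∈ₗ dihedrals → Σ ℕ λ c → c < p × H ≡ ⟨r^ p ,r^ c s⟩
  ∈-dihedrals⁻ = ∈-applyUpTo⁻ _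

  ∈-reflections⁻ : ∀ {H} → H ∈ₗ reflections → Σ ℕ λ k → k < N × H ≡ ⟨r^ N ,r^ k s⟩
  ∈-reflections⁻ = ∈-applyUpTo⁻ _

  ∈-canonicals⁻ : ∀ {H} → H ∈ₗ canonicals → Canonical H
  ∈-canonicals⁻ (here refl)         = rotations
  ∈-canonicals⁻ (there (here refl)) = p-rotations
  ∈-canonicals⁻ (there (there H∈)) with ∈-++⁻ dihedrals H∈
  ... | inj₁ H∈D with _ , c<p , refl ← ∈-dihedrals⁻ H∈D = dihedral c<p
  ... | inj₂ H∈R with _ , k<N , refl ← ∈-reflections⁻ H∈R = reflection k<N

  ≢-by : ∀ {H K} x → x ∈G H → ¬ (x ∈G K) → H ≢ K
  ≢-by x x∈H x∉K H≡K = x∉K (subst (x ∈G_) H≡K x∈H)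

  ⟨r^d,r^cs⟩-injective : ∀ {d} .{{_ : NonZero d}} {c c′} → c < N → c < d →
                         ⟨r^ d ,r^ c s⟩ ≡ ⟨r^ d ,r^ c′ s⟩ → c ≡ c′
  ⟨r^d,r^cs⟩-injective {d} c<N c<d H≡K = trans (sym (m<n⇒m%n≡m c<d))
    (trans (cong (_% d) (sym (toℕ-fromℕ< c<N)))
           (∈Class⁻ (subst (fromℕ< c<N ∈_) (cong proj₂ H≡K) (fromℕ<-∈Class′ c<N c<d))))

  tail-has-reflection : ∀ {H} → H ∈ₗ dihedrals ++ reflections → Nonempty (proj₂ H)
  tail-has-reflection H∈ with ∈-++⁻ dihedrals H∈
  ... | inj₁ H∈D with _ , c<p , refl ← ∈-dihedrals⁻ H∈D =
    fromℕ< (<-trans c<p p<N) , fromℕ<-∈Class′ (<-trans c<p p<N) c<p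
  ... | inj₂ H∈R with _ , k<N , refl ← ∈-reflections⁻ H∈R = fromℕ< k<N , fromℕ<-∈Class′ k<N k<N

  r¹∉tail : ∀ {H} → H ∈ₗ ⟨r^ p ⟩ ∷ dihedrals ++ reflections → ¬ (r¹ ∈G H)
  r¹∉tail (here refl) = r¹∉⟨r^d⟩ 1<p
  r¹∉tail (there H∈) with ∈-++⁻ dihedrals H∈
  ... | inj₁ H∈D with _ , _ , refl ← ∈-dihedrals⁻ H∈D = r¹∉⟨r^d⟩ 1<p
  ... | inj₂ H∈R with _ , _ , refl ← ∈-reflections⁻ H∈R = r¹∉⟨r^d⟩ 1<N

  rᵖ∉⟨r^N⟩ : ¬ (rᵖ ∈G ⟨r^ N ⟩)
  rᵖ∉⟨r^N⟩ = fromℕ<-∉Class p<N (λ p≡0 → 1+n≢0 (trans (sym (m<n⇒m%n≡m p<N)) p≡0))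

  canonicals-unique : Unique canonicals
  canonicals-unique =
    All.tabulate (λ H∈ → ≢-by r¹ (∈Class⁺ (n%1≡0 (toℕ (fromℕ< 1<N)))) (r¹∉tail H∈)) ∷
    All.tabulate (λ H∈ → let a , a∈ = tail-has-reflection H∈ in ≢-by (a , true) a∈ ∉⊥ ∘ sym) ∷
    Unique.++⁺
      (Unique.applyUpTo⁺₁ _ p λ i<j j<p →
        <⇒≢ i<j ∘ ⟨r^d,r^cs⟩-injective (<-trans (<-trans i<j j<p) p<N) (<-trans i<j j<p))
      (Unique.applyUpTo⁺₁ _ N λ i<j j<N →
        <⇒≢ i<j ∘ ⟨r^d,r^cs⟩-injective (<-trans i<j j<N) (<-trans i<j j<N))
      disjoint
    where
      disjoint : ∀ {H} → ¬ (H ∈ₗ dihedrals × H ∈ₗ reflections)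
      disjoint (H∈D , H∈R) with _ , _ , refl ← ∈-dihedrals⁻ H∈D | _ , _ , H≡ ← ∈-reflections⁻ H∈R =
        ≢-by rᵖ rᵖ∈⟨r^p⟩ rᵖ∉⟨r^N⟩ H≡

  V↭canonicals : V ↭ canonicals
  V↭canonicals = ∼bag⇒↭ (unique∧set⇒bag V-unique canonicals-unique λ {H} → mk⇔
    (∈-canonicals⁺ ∘ vertex⇒canonical ∘ ∈V⁻) (∈V⁺ ∘ canonical⇒vertex ∘ ∈-canonicals⁻))

  adj-sym : ∀ {H K} → Adj H K → Adj K H
  adj-sym (H≢K , x , x≢e , x∈H , x∈K) = (H≢K ∘ sym) , x , x≢e , x∈K , x∈H

  adj-via-rᵖ : ∀ {H K} → H ≢ K → rᵖ ∈G H → rᵖ ∈G K → Adj H K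
  adj-via-rᵖ H≢K rᵖ∈H rᵖ∈K = H≢K , rᵖ , rᵖ≢e , rᵖ∈H , rᵖ∈K

  ⟨r^p,r^cs⟩-adj-⟨r^N,r^ks⟩ : ∀ {k} (k<N : k < N) → Adj ⟨r^ p ,r^ (k % p) s⟩ ⟨r^ N ,r^ k s⟩
  ⟨r^p,r^cs⟩-adj-⟨r^N,r^ks⟩ k<N =
    ≢-by rᵖ rᵖ∈⟨r^p⟩ rᵖ∉⟨r^N⟩ , rᵏs k<N , (λ ()) , fromℕ<-∈Class k<N , rᵏs∈⟨r^N,r^ks⟩ k<N

  HasReflection : ℕ → SubG → Set
  HasReflection k H = Σ (Fin N) λ a → toℕ a ≡ k × a ∈ proj₂ H

  ⟨r^N,r^ks⟩-adj⇒ : ∀ {k K} → Adj ⟨r^ N ,r^ k s⟩ K → HasReflection k K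
  ⟨r^N,r^ks⟩-adj⇒ (_ , (a , false) , a≢e , a∈H , _) =
    contradiction (cong (_, false) (toℕ-injective (trans (sym (toℕ%N m a)) (∈Class⁻ a∈H)))) a≢e
  ⟨r^N,r^ks⟩-adj⇒ (_ , (a , true) , _ , a∈H , a∈K) = a , trans (sym (toℕ%N m a)) (∈Class⁻ a∈H) , a∈K

  reflections-congruent : ∀ {W k k′} → Canonical W → HasReflection k W → HasReflection k′ W → k % p ≡ k′ % p
  reflections-congruent rotations      (_ , _ , a∈) _ = contradiction a∈ ∉⊥
  reflections-congruent p-rotations    (_ , _ , a∈) _ = contradiction a∈ ∉⊥
  reflections-congruent (dihedral _)   (_ , refl , a∈) (_ , refl , b∈) = trans (∈Class⁻ a∈) (sym (∈Class⁻ b∈))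
  reflections-congruent (reflection _) (a , refl , a∈) (b , refl , b∈) =
    cong (_% p) (trans (sym (toℕ%N m a)) (trans (∈Class⁻ a∈) (sym (trans (sym (toℕ%N m b)) (∈Class⁻ b∈)))))

  r¹∈⟨r^1⟩ : r¹ ∈G ⟨r^ 1 ⟩
  r¹∈⟨r^1⟩ = ∈Class⁺ (n%1≡0 (toℕ (fromℕ< 1<N)))

  ⟨r^1⟩≢⟨r^p,r^cs⟩ : ∀ {c} → ⟨r^ 1 ⟩ ≢ ⟨r^ p ,r^ c s⟩
  ⟨r^1⟩≢⟨r^p,r^cs⟩ = ≢-by r¹ r¹∈⟨r^1⟩ (r¹∉⟨r^d⟩ 1<p)

  ⟨r^p⟩≢⟨r^p,r^cs⟩ : ∀ {c} → c < p → ⟨r^ p ⟩ ≢ ⟨r^ p ,r^ c s⟩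
  ⟨r^p⟩≢⟨r^p,r^cs⟩ c<p = ≢-by (rᵏs c<N) (fromℕ<-∈Class′ c<N c<p) ∉⊥ ∘ sym
    where c<N = <-trans c<p p<N

  ¬adj-self : ∀ {H} → ¬ Adj H H
  ¬adj-self (H≢H , _) = H≢H refl

  ¬⟨r^d⟩-adj-⟨r^N,r^ks⟩ : ∀ {d} .{{_ : NonZero d}} {k} → ¬ Adj ⟨r^ d ⟩ ⟨r^ N ,r^ k s⟩
  ¬⟨r^d⟩-adj-⟨r^N,r^ks⟩ adj = let _ , _ , a∈∅ = ⟨r^N,r^ks⟩-adj⇒ (adj-sym adj) in ∉⊥ a∈∅

  ⟨r^N,r^ks⟩-adj-⟨r^p,r^cs⟩⇒ : ∀ {k c} → Adj ⟨r^ N ,r^ k s⟩ ⟨r^ p ,r^ c s⟩ → k % p ≡ c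
  ⟨r^N,r^ks⟩-adj-⟨r^p,r^cs⟩⇒ adj =
    let a , a≡k , a∈ = ⟨r^N,r^ks⟩-adj⇒ adj in trans (cong (_% p) (sym a≡k)) (∈Class⁻ a∈)

  ¬⟨r^N,r^ks⟩-adj-⟨r^N,r^ks⟩ : ∀ {k k′} → ¬ Adj ⟨r^ N ,r^ k s⟩ ⟨r^ N ,r^ k′ s⟩
  ¬⟨r^N,r^ks⟩-adj-⟨r^N,r^ks⟩ adj@(H≢K , _) with a , a≡k , a∈ ← ⟨r^N,r^ks⟩-adj⇒ adj =
    H≢K (cong ⟨r^ N ,r^_s⟩ (trans (sym a≡k) (trans (sym (toℕ%N m a)) (∈Class⁻ a∈))))

  deg-split : ∀ H → deg H ≡ count (adj? H) (⟨r^ 1 ⟩ ∷ ⟨r^ p ⟩ ∷ [])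
                              + (count (adj? H) dihedrals + count (adj? H) reflections)
  deg-split H = trans (deg-↭ V↭canonicals H)
    (trans (count-++ (adj? H) (⟨r^ 1 ⟩ ∷ ⟨r^ p ⟩ ∷ []) (dihedrals ++ reflections))
           (cong (count (adj? H) (⟨r^ 1 ⟩ ∷ ⟨r^ p ⟩ ∷ []) +_) (count-++ (adj? H) dihedrals reflections)))

  ⟨r^1⟩-adj-⟨r^p⟩ : Adj ⟨r^ 1 ⟩ ⟨r^ p ⟩
  ⟨r^1⟩-adj-⟨r^p⟩ = adj-via-rᵖ (≢-by r¹ r¹∈⟨r^1⟩ (r¹∉⟨r^d⟩ 1<p)) rᵖ∈⟨r^1⟩ rᵖ∈⟨r^p⟩

  deg-⟨r^1⟩ : deg ⟨r^ 1 ⟩ ≡ suc p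
  deg-⟨r^1⟩ = begin
    deg ⟨r^ 1 ⟩   ≡⟨ deg-split ⟨r^ 1 ⟩ ⟩
    _             ≡⟨ cong₂ _+_ heads (cong₂ _+_ dihedral-neighbours reflection-neighbours) ⟩
    1 + (p + 0)   ≡⟨ cong suc (+-identityʳ p) ⟩
    suc p         ∎
    where
      open ≡-Reasoning
      heads : count (adj? ⟨r^ 1 ⟩) (⟨r^ 1 ⟩ ∷ ⟨r^ p ⟩ ∷ []) ≡ 1
      heads = trans (count-∷-reject (adj? ⟨r^ 1 ⟩) (⟨r^ p ⟩ ∷ []) ¬adj-self)
                    (count-∷-accept (adj? ⟨r^ 1 ⟩) [] ⟨r^1⟩-adj-⟨r^p⟩)
      dihedral-neighbours : count (adj? ⟨r^ 1 ⟩) dihedrals ≡ p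
      dihedral-neighbours = count-applyUpTo-all (adj? ⟨r^ 1 ⟩) ⟨r^ p ,r^_s⟩ p
        λ _ → adj-via-rᵖ ⟨r^1⟩≢⟨r^p,r^cs⟩ rᵖ∈⟨r^1⟩ rᵖ∈⟨r^p⟩
      reflection-neighbours : count (adj? ⟨r^ 1 ⟩) reflections ≡ 0
      reflection-neighbours = count-applyUpTo-none (adj? ⟨r^ 1 ⟩) ⟨r^ N ,r^_s⟩ N λ _ → ¬⟨r^d⟩-adj-⟨r^N,r^ks⟩

  deg-⟨r^p⟩ : deg ⟨r^ p ⟩ ≡ suc p
  deg-⟨r^p⟩ = begin
    deg ⟨r^ p ⟩   ≡⟨ deg-split ⟨r^ p ⟩ ⟩
    _             ≡⟨ cong₂ _+_ heads (cong₂ _+_ dihedral-neighbours reflection-neighbours) ⟩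
    1 + (p + 0)   ≡⟨ cong suc (+-identityʳ p) ⟩
    suc p         ∎
    where
      open ≡-Reasoning
      heads : count (adj? ⟨r^ p ⟩) (⟨r^ 1 ⟩ ∷ ⟨r^ p ⟩ ∷ []) ≡ 1
      heads = trans (count-∷-accept (adj? ⟨r^ p ⟩) (⟨r^ p ⟩ ∷ []) (adj-sym ⟨r^1⟩-adj-⟨r^p⟩))
                    (cong suc (count-∷-reject (adj? ⟨r^ p ⟩) [] ¬adj-self))
      dihedral-neighbours : count (adj? ⟨r^ p ⟩) dihedrals ≡ p
      dihedral-neighbours = count-applyUpTo-all (adj? ⟨r^ p ⟩) ⟨r^ p ,r^_s⟩ p
        λ c<p → adj-via-rᵖ (⟨r^p⟩≢⟨r^p,r^cs⟩ c<p) rᵖ∈⟨r^p⟩ rᵖ∈⟨r^p⟩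
      reflection-neighbours : count (adj? ⟨r^ p ⟩) reflections ≡ 0
      reflection-neighbours = count-applyUpTo-none (adj? ⟨r^ p ⟩) ⟨r^ N ,r^_s⟩ N λ _ → ¬⟨r^d⟩-adj-⟨r^N,r^ks⟩

  deg-⟨r^p,r^cs⟩ : ∀ {c} → c < p → deg ⟨r^ p ,r^ c s⟩ ≡ suc (p + p)
  deg-⟨r^p,r^cs⟩ {c} c<p = begin
    deg ⟨r^ p ,r^ c s⟩            ≡⟨ deg-split ⟨r^ p ,r^ c s⟩ ⟩
    _                             ≡⟨ cong₂ _+_ heads (cong₂ _+_ dihedral-neighbours reflection-neighbours) ⟩
    2 + (count (∁? (_≟ c)) (upTo p) + p) ≡⟨ cong (λ x → suc (x + p)) others ⟩
    suc (p + p)                   ∎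
    where
      open ≡-Reasoning
      Dc = ⟨r^ p ,r^ c s⟩
      c<N = <-trans c<p p<N
      heads : count (adj? Dc) (⟨r^ 1 ⟩ ∷ ⟨r^ p ⟩ ∷ []) ≡ 2
      heads = trans (count-∷-accept (adj? Dc) _ (adj-via-rᵖ (⟨r^1⟩≢⟨r^p,r^cs⟩ ∘ sym) rᵖ∈⟨r^p⟩ rᵖ∈⟨r^1⟩))
                (cong suc (count-∷-accept (adj? Dc) []
                  (adj-via-rᵖ (⟨r^p⟩≢⟨r^p,r^cs⟩ c<p ∘ sym) rᵖ∈⟨r^p⟩ rᵖ∈⟨r^p⟩)))
      dihedral-neighbours : count (adj? Dc) dihedrals ≡ count (∁? (_≟ c)) (upTo p)
      dihedral-neighbours = count-applyUpTo (adj? Dc) ⟨r^ p ,r^_s⟩ p (∁? (_≟ c))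
        (λ _ adj i≡c → ¬adj-self (subst (λ i → Adj Dc ⟨r^ p ,r^ i s⟩) i≡c adj))
        (λ _ i≢c → adj-via-rᵖ (i≢c ∘ sym ∘ ⟨r^d,r^cs⟩-injective c<N c<p) rᵖ∈⟨r^p⟩ rᵖ∈⟨r^p⟩)
      reflection-neighbours : count (adj? Dc) reflections ≡ p
      reflection-neighbours = trans (count-applyUpTo (adj? Dc) ⟨r^ N ,r^_s⟩ N (λ k → k % p ≟ c)
        (λ _ → ⟨r^N,r^ks⟩-adj-⟨r^p,r^cs⟩⇒ ∘ adj-sym)
        (λ k<N k≡c → subst (λ c → Adj ⟨r^ p ,r^ c s⟩ _) k≡c (⟨r^p,r^cs⟩-adj-⟨r^N,r^ks⟩ k<N)))
        (count-residue p p c<p)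
      others : suc (count (∁? (_≟ c)) (upTo p)) ≡ p
      others = begin
        suc (count (∁? (_≟ c)) (upTo p))
          ≡⟨ cong (_+ count (∁? (_≟ c)) (upTo p)) (count-≟-unique _≟_ (Unique.upTo⁺ p) (∈-upTo⁺ c<p)) ⟨
        count (_≟ c) (upTo p) + count (∁? (_≟ c)) (upTo p)        ≡⟨ count+count-∁ (_≟ c) (upTo p) ⟩
        length (upTo p)                                           ≡⟨ length-upTo p ⟩
        p                                                         ∎

  deg-⟨r^N,r^ks⟩ : ∀ {k} → k < N → deg ⟨r^ N ,r^ k s⟩ ≡ 1
  deg-⟨r^N,r^ks⟩ {k} k<N = begin
    deg Rk         ≡⟨ deg-split Rk ⟩
    _              ≡⟨ cong₂ _+_ heads (cong₂ _+_ dihedral-neighbours reflection-neighbours) ⟩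
    1              ∎
    where
      open ≡-Reasoning
      Rk = ⟨r^ N ,r^ k s⟩
      heads : count (adj? Rk) (⟨r^ 1 ⟩ ∷ ⟨r^ p ⟩ ∷ []) ≡ 0
      heads = trans (count-∷-reject (adj? Rk) _ (¬⟨r^d⟩-adj-⟨r^N,r^ks⟩ ∘ adj-sym))
                    (count-∷-reject (adj? Rk) [] (¬⟨r^d⟩-adj-⟨r^N,r^ks⟩ ∘ adj-sym))
      dihedral-neighbours : count (adj? Rk) dihedrals ≡ 1
      dihedral-neighbours = trans (count-applyUpTo (adj? Rk) ⟨r^ p ,r^_s⟩ p (_≟ k % p)
        (λ _ → sym ∘ ⟨r^N,r^ks⟩-adj-⟨r^p,r^cs⟩⇒)
        (λ _ c≡k → adj-sym (subst (λ c → Adj ⟨r^ p ,r^ c s⟩ Rk) (sym c≡k) (⟨r^p,r^cs⟩-adj-⟨r^N,r^ks⟩ k<N))))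
        (count-≟-unique _≟_ (Unique.upTo⁺ p) (∈-upTo⁺ (m%n<n k p)))
      reflection-neighbours : count (adj? Rk) reflections ≡ 0
      reflection-neighbours = count-applyUpTo-none (adj? Rk) ⟨r^ N ,r^_s⟩ N λ _ → ¬⟨r^N,r^ks⟩-adj-⟨r^N,r^ks⟩

  canonical∈V : ∀ {H} → Canonical H → H ∈ₗ V
  canonical∈V = ∈V⁺ ∘ canonical⇒vertex

  ∈V⇒canonical : ∀ {H} → H ∈ₗ V → Canonical H
  ∈V⇒canonical = vertex⇒canonical ∘ ∈V⁻

  Reach-1-via-rᵖ : ∀ {H K} → Canonical H → rᵖ ∈G H → rᵖ ∈G K → Reach 1 H K
  Reach-1-via-rᵖ {H} {K} cH rᵖ∈H rᵖ∈K = via (H ≟S K)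
    where
      via : Dec (H ≡ K) → Reach 1 H K
      via (yes H≡K) = inj₁ H≡K
      via (no  H≢K) = Reach-step refl (canonical∈V cH) (adj-via-rᵖ H≢K rᵖ∈H rᵖ∈K)

  Reach-2-from-rᵖ : ∀ {H K} → Canonical H → rᵖ ∈G H → Canonical K → Reach 2 H K
  Reach-2-from-rᵖ cH rᵖ∈H rotations      = inj₁ (Reach-1-via-rᵖ cH rᵖ∈H rᵖ∈⟨r^1⟩)
  Reach-2-from-rᵖ cH rᵖ∈H p-rotations    = inj₁ (Reach-1-via-rᵖ cH rᵖ∈H rᵖ∈⟨r^p⟩)
  Reach-2-from-rᵖ cH rᵖ∈H (dihedral _)   = inj₁ (Reach-1-via-rᵖ cH rᵖ∈H rᵖ∈⟨r^p⟩)
  Reach-2-from-rᵖ cH rᵖ∈H (reflection {k} k<N) =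
    Reach-step (Reach-1-via-rᵖ cH rᵖ∈H rᵖ∈⟨r^p⟩) (canonical∈V (dihedral (m%n<n k p)))
               (⟨r^p,r^cs⟩-adj-⟨r^N,r^ks⟩ k<N)

  Reach-3-from-⟨r^N,r^ks⟩ : ∀ {k K} → k < N → Canonical K → Reach 3 ⟨r^ N ,r^ k s⟩ K
  Reach-3-from-⟨r^N,r^ks⟩ {k} k<N cK = Reach-trans 2
    (Reach-step refl (canonical∈V (reflection k<N)) (adj-sym (⟨r^p,r^cs⟩-adj-⟨r^N,r^ks⟩ k<N)))
    (Reach-2-from-rᵖ (dihedral (m%n<n k p)) rᵖ∈⟨r^p⟩ cK)

  ¬Reach-1-⟨r^N,r^ks⟩ : ∀ {H k} → rᵖ ∈G H → ¬ HasReflection k H → ¬ Reach 1 H ⟨r^ N ,r^ k s⟩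
  ¬Reach-1-⟨r^N,r^ks⟩ rᵖ∈H rᵏs∉H r with Reach-1⇒ r
  ... | inj₁ refl = rᵖ∉⟨r^N⟩ rᵖ∈H
  ... | inj₂ adj  = rᵏs∉H (⟨r^N,r^ks⟩-adj⇒ (adj-sym adj))

  Reach-1-from-⟨r^N,r^ks⟩⇒ : ∀ {k W} → k < N → Reach 1 ⟨r^ N ,r^ k s⟩ W → HasReflection k W
  Reach-1-from-⟨r^N,r^ks⟩⇒ k<N r with Reach-1⇒ r
  ... | inj₁ refl = fromℕ< k<N , toℕ-fromℕ< k<N , rᵏs∈⟨r^N,r^ks⟩ k<N
  ... | inj₂ adj  = ⟨r^N,r^ks⟩-adj⇒ adj

  ¬Reach-2-⟨r^N,r^ks⟩ : ∀ {k k′} → k < N → k′ < N → k % p ≢ k′ % p →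
                        ¬ Reach 2 ⟨r^ N ,r^ k s⟩ ⟨r^ N ,r^ k′ s⟩
  ¬Reach-2-⟨r^N,r^ks⟩ k<N k′<N k≢k′ (inj₁ r) = k≢k′ (reflections-congruent (reflection k′<N)
    (Reach-1-from-⟨r^N,r^ks⟩⇒ k<N r) (fromℕ< k′<N , toℕ-fromℕ< k′<N , rᵏs∈⟨r^N,r^ks⟩ k′<N))
  ¬Reach-2-⟨r^N,r^ks⟩ k<N k′<N k≢k′ (inj₂ any) = via-middle (find any)
    where
      via-middle : ¬ Σ SubG λ W → W ∈ₗ V × Reach 1 ⟨r^ N ,r^ _ s⟩ W × Adj W ⟨r^ N ,r^ _ s⟩
      via-middle (W , W∈V , r , adj) =
        k≢k′ (reflections-congruent (∈V⇒canonical W∈V)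
               (Reach-1-from-⟨r^N,r^ks⟩⇒ k<N r) (⟨r^N,r^ks⟩-adj⇒ (adj-sym adj)))

  3<∣V∣ : 3 < length V
  3<∣V∣ = subst (λ n → 3 < n) (sym (length-V V↭canonicals)) (s≤s (s≤s (s≤s (s≤s z≤n))))

  ecc-via-rᵖ : ∀ {H k} → Canonical H → rᵖ ∈G H → k < N → ¬ HasReflection k H → ecc H ≡ 2
  ecc-via-rᵖ {H} {k} cH rᵖ∈H k<N rᵏs∉H = ecc-≡ {H} {1} ⟨r^ N ,r^ k s⟩ (<-trans (n<1+n 2) 3<∣V∣)
    (Reach-2-from-rᵖ cH rᵖ∈H ∘ ∈V⇒canonical) (canonical∈V (reflection k<N)) (¬Reach-1-⟨r^N,r^ks⟩ rᵖ∈H rᵏs∉H)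

  0<N : 0 < N
  0<N = <-trans z<s 1<N

  far : ℕ → ℕ
  far zero    = 1
  far (suc _) = 0

  far<N : ∀ c → far c < N
  far<N zero    = 1<N
  far<N (suc _) = 0<N

  far-% : ∀ c → far c % p ≢ c
  far-% zero    ()
  far-% (suc _) ()

  ecc-⟨r^1⟩ : ecc ⟨r^ 1 ⟩ ≡ 2
  ecc-⟨r^1⟩ = ecc-via-rᵖ rotations rᵖ∈⟨r^1⟩ 0<N λ (_ , _ , a∈) → ∉⊥ a∈

  ecc-⟨r^p⟩ : ecc ⟨r^ p ⟩ ≡ 2
  ecc-⟨r^p⟩ = ecc-via-rᵖ p-rotations rᵖ∈⟨r^p⟩ 0<N λ (_ , _ , a∈) → ∉⊥ a∈

  ecc-⟨r^p,r^cs⟩ : ∀ {c} → c < p → ecc ⟨r^ p ,r^ c s⟩ ≡ 2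
  ecc-⟨r^p,r^cs⟩ {c} c<p = ecc-via-rᵖ (dihedral c<p) rᵖ∈⟨r^p⟩ (far<N c)
    λ (_ , a≡far , a∈) → far-% c (trans (cong (_% p) (sym a≡far)) (∈Class⁻ a∈))

  ecc-⟨r^N,r^ks⟩ : ∀ {k} → k < N → ecc ⟨r^ N ,r^ k s⟩ ≡ 3
  ecc-⟨r^N,r^ks⟩ {k} k<N = ecc-≡ {⟨r^ N ,r^ k s⟩} {2} ⟨r^ N ,r^ far (k % p) s⟩ 3<∣V∣
    (Reach-3-from-⟨r^N,r^ks⟩ k<N ∘ ∈V⇒canonical)
    (canonical∈V (reflection (far<N (k % p)))) (¬Reach-2-⟨r^N,r^ks⟩ k<N (far<N (k % p)) (far-% (k % p) ∘ sym))

  weight-⟨r^1⟩ : weight ⟨r^ 1 ⟩ ≡ suc p * 2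
  weight-⟨r^1⟩ = trans (weight-≡ _) (cong₂ _*_ deg-⟨r^1⟩ ecc-⟨r^1⟩)

  weight-⟨r^p⟩ : weight ⟨r^ p ⟩ ≡ suc p * 2
  weight-⟨r^p⟩ = trans (weight-≡ _) (cong₂ _*_ deg-⟨r^p⟩ ecc-⟨r^p⟩)

  weight-⟨r^p,r^cs⟩ : ∀ {c} → c < p → weight ⟨r^ p ,r^ c s⟩ ≡ suc (p + p) * 2
  weight-⟨r^p,r^cs⟩ c<p = trans (weight-≡ _) (cong₂ _*_ (deg-⟨r^p,r^cs⟩ c<p) (ecc-⟨r^p,r^cs⟩ c<p))

  weight-⟨r^N,r^ks⟩ : ∀ {k} → k < N → weight ⟨r^ N ,r^ k s⟩ ≡ 1 * 3
  weight-⟨r^N,r^ks⟩ k<N = trans (weight-≡ _) (cong₂ _*_ (deg-⟨r^N,r^ks⟩ k<N) (ecc-⟨r^N,r^ks⟩ k<N))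

  sum-weight-dihedrals : sum (map weight dihedrals) ≡ p * (suc (p + p) * 2)
  sum-weight-dihedrals = trans (sum-map-const weight dihedrals w) (cong (_* (suc (p + p) * 2)) (length-applyUpTo ⟨r^ p ,r^_s⟩ p))
    where
      w : ∀ {H} → H ∈ₗ dihedrals → weight H ≡ suc (p + p) * 2
      w H∈ with _ , c<p , refl ← ∈-dihedrals⁻ H∈ = weight-⟨r^p,r^cs⟩ c<p

  sum-weight-reflections : sum (map weight reflections) ≡ N * (1 * 3)
  sum-weight-reflections = trans (sum-map-const weight reflections w) (cong (_* (1 * 3)) (length-applyUpTo ⟨r^ N ,r^_s⟩ N))
    where
      w : ∀ {H} → H ∈ₗ reflections → weight H ≡ 1 * 3
      w H∈ with _ , k<N , refl ← ∈-reflections⁻ H∈ = weight-⟨r^N,r^ks⟩ k<N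

  ξc-value : ξc ≡ 7 * p ^ 2 + 6 * p + 4
  ξc-value = begin
    ξc
      ≡⟨ ξc-↭ V↭canonicals ⟩
    weight ⟨r^ 1 ⟩ + (weight ⟨r^ p ⟩ + sum (map weight (dihedrals ++ reflections)))
      ≡⟨ cong₂ (λ a b → a + (b + sum (map weight (dihedrals ++ reflections)))) weight-⟨r^1⟩ weight-⟨r^p⟩ ⟩
    suc p * 2 + (suc p * 2 + sum (map weight (dihedrals ++ reflections)))
      ≡⟨ cong (λ x → suc p * 2 + (suc p * 2 + x))
              (trans (cong sum (map-++ weight dihedrals reflections)) (sum-++ (map weight dihedrals) (map weight reflections))) ⟩
    suc p * 2 + (suc p * 2 + (sum (map weight dihedrals) + sum (map weight reflections)))
      ≡⟨ cong (λ x → suc p * 2 + (suc p * 2 + x)) (cong₂ _+_ sum-weight-dihedrals sum-weight-reflections) ⟩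
    suc p * 2 + (suc p * 2 + (p * (suc (p + p) * 2) + N * (1 * 3)))
      ≡⟨ ξc-arithmetic p ⟩
    7 * p ^ 2 + 6 * p + 4
      ∎
    where open ≡-Reasoning
-- Proved for a variable m: at the concrete m of the theorem, checking it would unfold ξc.
ξcD-suc : ∀ m → ξcD (suc m) ≡ Dihedral.ξc m
ξcD-suc m = refl

theorem3p7 : (p : ℕ) → Prime p → ξcD (p ^ 2) ≡ 7 * p ^ 2 + 6 * p + 4
theorem3p7 0             isPrime = contradiction isPrime ¬prime[0]
theorem3p7 1             isPrime = contradiction isPrime ¬prime[1]
theorem3p7 (suc (suc q)) isPrime = begin
  ξcD (p ^ 2)                  ≡⟨ cong ξcD p²≡N ⟩
  ξcD (suc m)                  ≡⟨ ξcD-suc m ⟩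
  Dihedral.ξc m                ≡⟨ ξc-value ⟩
  7 * p ^ 2 + 6 * p + 4        ∎
  where
    open ≡-Reasoning
    open PrimeSquare q isPrime using (p; m; ξc-value)
    p²≡N : p ^ 2 ≡ suc m
    p²≡N = cong (p *_) (*-identityʳ p)
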